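{- The following algorithm for $\operatorname{BLOCK}$ is correct: on input lists $A_0,\dots,A_{m-1}$ its successive calls to next return, each exactly once, precisely the intervals of $\operatorname{BLOCK}(A_0,\dots,A_{m-1})$, and then $\text{null}$. Algorithm: keep a current interval $[\ell_k\..r_k]$ for each $0\le k<m$, initially $[-\infty\..-\infty]$. next: if $A_0$ is exhausted return $\text{null}$; $[\ell_0\..r_0]\leftarrow$ next$(A_0)$; $i\leftarrow1$; while $i<m$ do \{ while $\ell_i\le r_{i-1}$ do \{ if $A_i$ is exhausted return $\text{null}$; $[\ell_i\..r_i]\leftarrow$ next$(A_i)$ \}; if $\ell_i=r_{i-1}+1$ then $i\leftarrow i+1$, else \{ if $A_0$ is exhausted return $\text{null}$; $[\ell_0\..r_0]\leftarrow$ next$(A_0)$; $i\leftarrow1$ \} \}; return $[\ell_0\..r_{m-1}]$.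
   Context: Let $O$ be a finite totally ordered set in which every element $x$ has a successor $x+1$ ($x<x+1$, and $x\le y\le x+1$ implies $y=x$ or $y=x+1$), accessed via comparisons and successor; $\pm\infty$ denote special elements strictly smaller/larger than every element of $O$. A subset $X\subseteq O$ is an interval if $x,y\in X$, $x<z<y$ imply $z\in X$; nonempty intervals are written $[\ell\..r]$. For intervals $I,J$, $I\ll J$ means $x<y$ for all $x\in I$, $y\in J$. An antichain of intervals is a set of intervals pairwise incomparable under inclusion, listed in natural order (by left extreme, equivalently right extreme). The input consists of $m$ lists $A_0,\dots,A_{m-1}$, each a nonempty antichain of nonempty intervals delivered in natural order via a next function that returns $\text{null}$ once exhausted. $\operatorname{BLOCK}(A_0,\dots,A_{m-1})$ is the set of intervals of the form $I_0\cup\dots\cup I_{m-1}$ with $I_i\in A_i$ and $I_{i-1}\ll I_i$ for $0<i<m$, where the union is itself an interval (i.e., consecutive intervals are adjacent). -}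

module Defs where

open import Level using (Level; _⊔_)
open import Data.Nat as ℕ using (ℕ; zero; suc; _+_; _*_)
open import Data.Nat.Properties using (_<?_)
open import Data.Fin using (Fin; zero; fromℕ<)
import Data.Fin
import Data.List
open import Data.Product using (Σ; ∃; _×_; _,_; proj₁; proj₂)
open import Data.Sum using (_⊎_)
open import Data.Maybe using (Maybe; just; nothing)
open import Data.List using (List; []; _∷_; length; map)
open import Data.Nat.ListAction using (sum)
open import Data.List.Membership.Propositional using (_∈_)
open import Data.List.Relation.Unary.AllPairs using (AllPairs)
open import Data.Vec.Functional using (updateAt)
open import Relation.Nullary using (¬_; yes; no)
open import Relation.Binary using (Rel; IsStrictTotalOrder)
open import Relation.Binary.PropositionalEquality using (_≡_)
open import Function.Bundles using (_⇔_)

record SuccOrder (a ℓ : Level) : Set (Level.suc (a ⊔ ℓ)) where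
  field
    Carrier            : Set a
    _<_                : Rel Carrier ℓ
    isStrictTotalOrder : IsStrictTotalOrder _≡_ _<_
    succ               : Carrier → Carrier
    succ-<             : ∀ x → x < succ x
    succ-cover         : ∀ x y → ¬ (x < y × y < succ x)
  open IsStrictTotalOrder isStrictTotalOrder public using (_≟_; _<?_)
  infix 4 _≤_
  _≤_ : Carrier → Carrier → Set (a ⊔ ℓ)
  x ≤ y = x < y ⊎ x ≡ y

module _ {a ℓ : Level} (O : SuccOrder a ℓ) where
  open SuccOrder O renaming (_<?_ to _<O?_)

  Interval : Set a
  Interval = Carrier × Carrier

  lo hi : Interval → Carrier
  lo = proj₁
  hi = proj₂

  _∈I_ : Carrier → Interval → Set (a ⊔ ℓ)
  x ∈I I = lo I ≤ x × x ≤ hi I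

  NonEmptyI : Interval → Set (a ⊔ ℓ)
  NonEmptyI I = lo I ≤ hi I

  _⊆I_ : Interval → Interval → Set (a ⊔ ℓ)
  I ⊆I J = ∀ x → x ∈I I → x ∈I J

  _≪_ : Interval → Interval → Set (a ⊔ ℓ)
  I ≪ J = ∀ x y → x ∈I I → y ∈I J → x < y

  IsAntichainList : List Interval → Set (a ⊔ ℓ)
  IsAntichainList As =
    AllPairs (λ I J → ¬ (I ⊆I J) × ¬ (J ⊆I I)) As × AllPairs (λ I J → lo I < lo J) As

  -- Membership in BLOCK(A_0,...,A_{m-1}) with m = suc n: J is (as a set)
  -- the union I_0 ∪ ... ∪ I_{m-1} with I_i ∈ A_i and I_{i-1} ≪ I_i.
  InBLOCK : (n : ℕ) → (Fin (suc n) → List Interval) → Interval → Set (a ⊔ ℓ)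
  InBLOCK n A J =
    Σ (Fin (suc n) → Interval) λ I →
      (∀ i → I i ∈ A i)
      × (∀ (i : Fin n) → I (Data.Fin.inject₁ i) ≪ I (Data.Fin.suc i))
      × (∀ x → (x ∈I J) ⇔ (∃ λ i → x ∈I I i))

  -- The algorithm.  State: the unread parts of the lists and the current
  -- interval of each list (nothing = [-∞..-∞]).
  record State (n : ℕ) : Set a where
    constructor mkState
    field
      rest : Fin (suc n) → List Interval
      cur  : Fin (suc n) → Maybe Interval
  open State

  initState : (n : ℕ) → (Fin (suc n) → List Interval) → State n
  initState n A = mkState A (λ _ → nothing)

  advance : {n : ℕ} → Fin (suc n) → Interval → List Interval → State n → State n
  advance k J js s = mkState (updateAt (rest s) k (λ _ → js)) (updateAt (cur s) k (λ _ → just J))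

  Result : ℕ → Set a
  Result n = Maybe Interval × State n

  module Run (n : ℕ) where
    m : ℕ
    m = suc n
    -- Arguments: fuel, index i, ℓ_0, r_{i-1}, state.  The fuel is only a
    -- termination device; runFuel below provides enough of it.
    mutual
      outer : ℕ → ℕ → Carrier → Carrier → State n → Result n
      outer zero    i l0 rp s = nothing , s
      outer (suc f) i l0 rp s with i <? m
      ... | no  _ = just (l0 , rp) , s
      ... | yes p = inner f (fromℕ< p) i l0 rp s

      -- the inner while loop at index k = i, followed by the test ℓ_i = r_{i-1}+1
      inner : ℕ → Fin (suc n) → ℕ → Carrier → Carrier → State n → Result n
      inner zero    k i l0 rp s = nothing , s
      inner (suc f) k i l0 rp s with cur s k
      ... | nothing = pull f k i l0 rp s
      ... | just (l , r) with rp <O? l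
      ...   | no  _ = pull f k i l0 rp s
      ...   | yes _ with l ≟ succ rp
      ...     | yes _ = outer f (suc i) l0 r s
      ...     | no  _ = restart f s

      pull : ℕ → Fin (suc n) → ℕ → Carrier → Carrier → State n → Result n
      pull f k i l0 rp s with rest s k
      ... | []     = nothing , s
      ... | J ∷ js = inner f k i l0 rp (advance k J js s)

      restart : ℕ → State n → Result n
      restart f s with rest s zero
      ... | []     = nothing , s
      ... | J ∷ js = outer f 1 (lo J) (hi J) (advance zero J js s)

    remaining : State n → ℕ
    remaining s = sum (Data.List.map length (Data.List.map (rest s) (Data.List.allFin m)))

    next : State n → Result n
    next s = restart (4 * suc (remaining s) * suc m) s

    calls : ℕ → State n → List (Maybe Interval)
    calls zero    s = []
    calls (suc j) s with next s
    ... | o , s' = o ∷ calls j s'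

-- Call a chain a choice I₀ ∈ A₀, …, I_{m-1} ∈ A_{m-1} in which each interval starts right after the
-- previous one ends; the blocks are exactly the spans of chains. In an antichain both extremes increase
-- along the list, so a chain is determined by its first interval, and blocks come in the order of their
-- first intervals. The algorithm keeps a cursor in every list, with two invariants: every chain whose
-- first interval has not been passed still lies at or after all cursors, and the current intervals of
-- lists 0, …, i-1 are adjacent and begin every chain through the current interval of A₀. Hence when i
-- reaches m they form the chain through that interval, and when list i overshoots r_{i-1} + 1 no chain
-- goes through the current interval of A₀, which can then be discarded. Every pull shortens a list, and
-- between two pulls the index climbs at most m levels, which bounds the work of each call.
module Submission where

open import Defs hiding (lo; hi)
import Defs
open import Level using (Level; _⊔_; Lift; lift)
open import Data.Nat as ℕ using (ℕ; zero; suc; _+_; _*_)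
import Data.Nat.Properties as ℕ
open import Data.Nat.Induction using (<-wellFounded)
open import Data.Nat.ListAction using (sum)
open import Data.Nat.Solver using (module +-*-Solver)
open import Data.Fin as Fin using (Fin; zero; suc; toℕ; inject₁; fromℕ)
import Data.Fin.Properties as Fin
open import Data.Fin.Induction using (<-weakInduction; <-weakInduction-startingFrom)
open import Data.Product using (Σ; ∃; _×_; _,_; proj₁; proj₂)
open import Data.Sum using (_⊎_; inj₁; inj₂)
open import Data.Empty using (⊥-elim)
open import Data.Maybe using (Maybe; just; nothing)
open import Data.List using (List; []; _∷_; _++_; [_]; fromMaybe; length; map; allFin)
open import Data.List.Properties using (++-assoc; map-∘; length-++-≤ʳ)
open import Data.List.Membership.Propositional using (_∈_; _∉_)
open import Data.List.Membership.Propositional.Properties using (∈-++⁺ʳ; ∈-++⁻; ∈-allFin)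
open import Data.List.Relation.Unary.Any using (here; there)
open import Data.List.Relation.Unary.Any.Properties using (¬Any[])
open import Data.List.Relation.Unary.All as All using (All)
open import Data.List.Relation.Unary.AllPairs as AllPairs using (AllPairs; []; _∷_)
open import Data.List.Relation.Unary.Unique.Propositional using (Unique)
open import Data.Vec.Functional using (updateAt)
open import Data.Vec.Functional.Properties using (updateAt-updates; updateAt-minimal)
open import Induction.WellFounded using (Acc; acc)
open import Relation.Nullary using (¬_; yes; no)
open import Relation.Binary using (Rel; IsStrictTotalOrder; tri<; tri≈; tri>)
import Relation.Binary.Construct.StrictToNonStrict as StrictToNonStrict
open import Relation.Binary.PropositionalEquality hiding ([_])
open import Function using (_∘_)
open import Function.Bundles using (_⇔_; mk⇔; Equivalence)

allPairs-++⁻ʳ : ∀ {a r} {A : Set a} {R : A → A → Set r} xs {ys} → AllPairs R (xs ++ ys) → AllPairs R ys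
allPairs-++⁻ʳ []       Rys        = Rys
allPairs-++⁻ʳ (_ ∷ xs) (_ ∷ Rxys) = allPairs-++⁻ʳ xs Rxys

sum-map-< : ∀ {a} {X : Set a} (f g : X → ℕ) {xs x} → (∀ y → f y ℕ.≤ g y) → x ∈ xs → f x ℕ.< g x →
            sum (map f xs) ℕ.< sum (map g xs)
sum-map-< f g {_ ∷ xs} f≤g (here refl) fx<gx = ℕ.+-mono-<-≤ fx<gx (sum-map-≤ xs)
  where
  sum-map-≤ : ∀ xs → sum (map f xs) ℕ.≤ sum (map g xs)
  sum-map-≤ []       = ℕ.z≤n
  sum-map-≤ (y ∷ ys) = ℕ.+-mono-≤ (f≤g y) (sum-map-≤ ys)
sum-map-< f g {y ∷ _} f≤g (there x∈) fx<gx = ℕ.+-mono-≤-< (f≤g y) (sum-map-< f g f≤g x∈ fx<gx)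

module SuccOrderProperties {a ℓ : Level} (O : SuccOrder a ℓ) where
  open SuccOrder O
  open IsStrictTotalOrder isStrictTotalOrder
    using (irrefl; compare; <-resp-≈; <-respʳ-≈; <-respˡ-≈) renaming (trans to <-trans)
  private module NonStrict = StrictToNonStrict _≡_ _<_

  <-irrefl : ∀ {x} → ¬ x < x
  <-irrefl = irrefl refl

  ≤-refl : ∀ {x} → x ≤ x
  ≤-refl = NonStrict.reflexive refl

  ≤-trans : ∀ {x y z} → x ≤ y → y ≤ z → x ≤ z
  ≤-trans = NonStrict.trans isEquivalence <-resp-≈ <-trans

  <-≤-trans : ∀ {x y z} → x < y → y ≤ z → x < z
  <-≤-trans = NonStrict.<-≤-trans <-trans <-respʳ-≈

  ≤-<-trans : ∀ {x y z} → x ≤ y → y < z → x < z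
  ≤-<-trans = NonStrict.≤-<-trans sym <-trans <-respˡ-≈

  ≤-antisym : ∀ {x y} → x ≤ y → y ≤ x → x ≡ y
  ≤-antisym = NonStrict.antisym isEquivalence <-trans irrefl

  ≤⇒≯ : ∀ {x y} → x ≤ y → ¬ y < x
  ≤⇒≯ x≤y y<x = <-irrefl (≤-<-trans x≤y y<x)

  ≮⇒≥ : ∀ {x y} → ¬ x < y → y ≤ x
  ≮⇒≥ {x} {y} x≮y with compare x y
  ... | tri< x<y _ _ = ⊥-elim (x≮y x<y)
  ... | tri≈ _ x≡y _ = inj₂ (sym x≡y)
  ... | tri> _ _ y<x = inj₁ y<x

  <⇒succ≤ : ∀ {x y} → x < y → succ x ≤ y
  <⇒succ≤ {x} {y} x<y = ≮⇒≥ (λ y<succx → succ-cover x y (x<y , y<succx))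

  monotone-by-steps : ∀ {n} (f : Fin (suc n) → Carrier) → (∀ j → f (inject₁ j) ≤ f (suc j)) →
                      ∀ {k k′} → k Fin.≤ k′ → f k ≤ f k′
  monotone-by-steps f step {k} =
    <-weakInduction-startingFrom (λ k′ → f k ≤ f k′) ≤-refl (λ j k≤j → ≤-trans k≤j (step j))

module IntervalLists {a ℓ : Level} (O : SuccOrder a ℓ) where
  open SuccOrder O
  open SuccOrderProperties O

  lo hi : Interval O → Carrier
  lo = Defs.lo O
  hi = Defs.hi O

  _⋖_ : Rel (Interval O) ℓ
  I ⋖ J = lo I < lo J × hi I < hi J

  Sorted : List (Interval O) → Set (a ⊔ ℓ)
  Sorted = AllPairs _⋖_

  lo<∧⊈⇒⋖ : ∀ {I J} → lo I < lo J → ¬ (_⊆I_ O J I) → I ⋖ J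
  lo<∧⊈⇒⋖ {I} {J} lo< J⊈I with hi I <? hi J
  ... | yes hi< = lo< , hi<
  ... | no  hi≮ =
    ⊥-elim (J⊈I (λ x (lo≤x , x≤hi) → inj₁ (<-≤-trans lo< lo≤x) , ≤-trans x≤hi (≮⇒≥ hi≮)))

  antichain⇒sorted : ∀ {Is} → IsAntichainList O Is → Sorted Is
  antichain⇒sorted = AllPairs.zipWith (λ ((_ , J⊈I) , lo<) → lo<∧⊈⇒⋖ lo< J⊈I)

  sorted⇒lo-injective : ∀ {Is I J} → Sorted Is → I ∈ Is → J ∈ Is → lo I ≡ lo J → I ≡ J
  sorted⇒lo-injective (_ ∷ _)   (here refl) (here refl) _ = refl
  sorted⇒lo-injective (I⋖ ∷ _)  (here refl) (there J∈) e =
    ⊥-elim (<-irrefl (subst (_< _) e (proj₁ (All.lookup I⋖ J∈))))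
  sorted⇒lo-injective (J⋖ ∷ _)  (there I∈) (here refl) e =
    ⊥-elim (<-irrefl (subst (_< _) (sym e) (proj₁ (All.lookup J⋖ I∈))))
  sorted⇒lo-injective (_ ∷ Is↑) (there I∈) (there J∈) e = sorted⇒lo-injective Is↑ I∈ J∈ e

  sorted-head-hi≤ : ∀ {I Is J} → Sorted (I ∷ Is) → J ∈ I ∷ Is → hi I ≤ hi J
  sorted-head-hi≤ _        (here refl) = ≤-refl
  sorted-head-hi≤ (I⋖ ∷ _) (there J∈)  = inj₁ (proj₂ (All.lookup I⋖ J∈))

module Blocks {a ℓ : Level} (O : SuccOrder a ℓ) (n : ℕ) (A : Fin (suc n) → List (Interval O))
              (nonEmpty : ∀ k → All (NonEmptyI O) (A k)) where
  open SuccOrder O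
  open SuccOrderProperties O
  open IntervalLists O

  record IsChain (I : Fin (suc n) → Interval O) : Set a where
    field
      member   : ∀ k → I k ∈ A k
      adjacent : ∀ j → lo (I (suc j)) ≡ succ (hi (I (inject₁ j)))

  span : (Fin (suc n) → Interval O) → Interval O
  span I = lo (I zero) , hi (I (fromℕ n))

  module Separated (I : Fin (suc n) → Interval O) (I-nonEmpty : ∀ k → NonEmptyI O (I k))
                   (gap : ∀ j → hi (I (inject₁ j)) < lo (I (suc j))) where

    lo-monotone : ∀ {k k′} → k Fin.≤ k′ → lo (I k) ≤ lo (I k′)
    lo-monotone = monotone-by-steps (λ k → lo (I k)) (λ j → inj₁ (≤-<-trans (I-nonEmpty (inject₁ j)) (gap j)))

    hi-monotone : ∀ {k k′} → k Fin.≤ k′ → hi (I k) ≤ hi (I k′)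
    hi-monotone = monotone-by-steps (λ k → hi (I k)) (λ j → inj₁ (<-≤-trans (gap j) (I-nonEmpty (suc j))))

    ∈-piece⇒∈-span : ∀ {x} i → _∈I_ O x (I i) → _∈I_ O x (span I)
    ∈-piece⇒∈-span i (lo≤x , x≤hi) =
      ≤-trans (lo-monotone ℕ.z≤n) lo≤x , ≤-trans x≤hi (hi-monotone (Fin.≤fromℕ i))

    ∉-gap : ∀ j {y} → hi (I (inject₁ j)) < y → y < lo (I (suc j)) → ∀ i → ¬ _∈I_ O y (I i)
    ∉-gap j hi<y y<lo i (lo≤y , y≤hi) with toℕ i ℕ.≤? toℕ j
    ... | yes i≤j =
      ≤⇒≯ (≤-trans y≤hi (hi-monotone (subst (toℕ i ℕ.≤_) (sym (Fin.toℕ-inject₁ j)) i≤j))) hi<y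
    ... | no  i≰j = ≤⇒≯ (≤-trans (lo-monotone (ℕ.≰⇒> i≰j)) lo≤y) y<lo

  module _ {I : Fin (suc n) → Interval O} (I-chain : IsChain I) where
    open IsChain I-chain

    private
      gap : ∀ j → hi (I (inject₁ j)) < lo (I (suc j))
      gap j = subst (hi (I (inject₁ j)) <_) (sym (adjacent j)) (succ-< _)

      open Separated I (λ k → All.lookup (nonEmpty k) (member k)) gap

      covered : ∀ k {x} → lo (I zero) ≤ x → x ≤ hi (I k) → ∃ λ i → _∈I_ O x (I i)
      covered = <-weakInduction (λ k → ∀ {x} → lo (I zero) ≤ x → x ≤ hi (I k) → ∃ λ i → _∈I_ O x (I i))
        (λ lo≤x x≤hi → zero , lo≤x , x≤hi) step
        where
        step : ∀ j → (∀ {x} → lo (I zero) ≤ x → x ≤ hi (I (inject₁ j)) → ∃ λ i → _∈I_ O x (I i)) →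
               ∀ {x} → lo (I zero) ≤ x → x ≤ hi (I (suc j)) → ∃ λ i → _∈I_ O x (I i)
        step j below {x} lo≤x x≤hi with hi (I (inject₁ j)) <? x
        ... | yes hi<x = suc j , subst (_≤ x) (sym (adjacent j)) (<⇒succ≤ hi<x) , x≤hi
        ... | no  hi≮x = below lo≤x (≮⇒≥ hi≮x)

    chain⇒InBLOCK : InBLOCK O n A (span I)
    chain⇒InBLOCK = I , member , I≪I , λ x → mk⇔ (λ (lo≤x , x≤hi) → covered (fromℕ n) lo≤x x≤hi)
                                                 (λ (i , x∈) → ∈-piece⇒∈-span i x∈)
      where
      I≪I : ∀ j → _≪_ O (I (inject₁ j)) (I (suc j))
      I≪I j x y (_ , x≤hi) (lo≤y , _) = ≤-<-trans x≤hi (<-≤-trans (gap j) lo≤y)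

  InBLOCK⇒chain : ∀ {J} → InBLOCK O n A J → ∃ λ I → IsChain I × J ≡ span I
  InBLOCK⇒chain {J} (I , member , I≪I , J≈⋃I) =
    I , record { member = member ; adjacent = adjacent } , cong₂ _,_ lo-J hi-J
    where
    I-nonEmpty : ∀ k → NonEmptyI O (I k)
    I-nonEmpty k = All.lookup (nonEmpty k) (member k)

    lo∈ : ∀ k → _∈I_ O (lo (I k)) (I k)
    lo∈ k = ≤-refl , I-nonEmpty k

    hi∈ : ∀ k → _∈I_ O (hi (I k)) (I k)
    hi∈ k = I-nonEmpty k , ≤-refl

    gap : ∀ j → hi (I (inject₁ j)) < lo (I (suc j))
    gap j = I≪I j _ _ (hi∈ (inject₁ j)) (lo∈ (suc j))

    open Separated I I-nonEmpty gap

    ∈J : ∀ {x} i → _∈I_ O x (I i) → _∈I_ O x J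
    ∈J i x∈ = Equivalence.from (J≈⋃I _) (i , x∈)

    ⋃I : ∀ {x} → _∈I_ O x J → ∃ λ i → _∈I_ O x (I i)
    ⋃I = Equivalence.to (J≈⋃I _)

    adjacent : ∀ j → lo (I (suc j)) ≡ succ (hi (I (inject₁ j)))
    adjacent j = ≤-antisym (≮⇒≥ no-gap) (<⇒succ≤ (gap j))
      where
      h = hi (I (inject₁ j))
      succ-h∈J : _∈I_ O (succ h) J
      succ-h∈J = ≤-trans (proj₁ (∈J _ (hi∈ (inject₁ j)))) (inj₁ (succ-< h)) ,
                 ≤-trans (<⇒succ≤ (gap j)) (proj₂ (∈J _ (lo∈ (suc j))))
      no-gap : ¬ succ h < lo (I (suc j))
      no-gap succ-h<lo = let i , succ-h∈ = ⋃I succ-h∈J in ∉-gap j (succ-< h) succ-h<lo i succ-h∈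

    lo-J : lo J ≡ lo (I zero)
    lo-J = let i , loJ∈ = ⋃I (≤-refl , ≤-trans loJ≤ (proj₂ (∈J zero (lo∈ zero))))
           in ≤-antisym loJ≤ (proj₁ (∈-piece⇒∈-span i loJ∈))
      where loJ≤ = proj₁ (∈J zero (lo∈ zero))

    hi-J : hi J ≡ hi (I (fromℕ n))
    hi-J = let i , hiJ∈ = ⋃I (≤-trans (proj₁ (∈J (fromℕ n) (hi∈ (fromℕ n)))) ≤hiJ , ≤-refl)
           in ≤-antisym (proj₂ (∈-piece⇒∈-span i hiJ∈)) ≤hiJ
      where ≤hiJ = proj₂ (∈J (fromℕ n) (hi∈ (fromℕ n)))

module AlgorithmState {a ℓ : Level} (O : SuccOrder a ℓ) (n : ℕ) where
  open IntervalLists O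

  St : Set a
  St = State O n

  cur : St → Fin (suc n) → Maybe (Interval O)
  cur = State.cur

  rest : St → Fin (suc n) → List (Interval O)
  rest = State.rest

  upcoming : St → Fin (suc n) → List (Interval O)
  upcoming s k = fromMaybe (cur s k) ++ rest s k

  upcoming-just : ∀ s k {c} → cur s k ≡ just c → upcoming s k ≡ c ∷ rest s k
  upcoming-just s k eq = cong (λ c → fromMaybe c ++ rest s k) eq

  upcoming-nothing : ∀ s k → cur s k ≡ nothing → upcoming s k ≡ rest s k
  upcoming-nothing s k eq = cong (λ c → fromMaybe c ++ rest s k) eq

  rest⊆upcoming : ∀ s k {I} → I ∈ rest s k → I ∈ upcoming s k
  rest⊆upcoming s k = ∈-++⁺ʳ (fromMaybe (cur s k))

  module _ {s : St} {k : Fin (suc n)} {J : Interval O} {js : List (Interval O)} where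

    upcoming-advance : upcoming (advance O k J js s) k ≡ J ∷ js
    upcoming-advance = cong₂ (λ c r → fromMaybe c ++ r) (updateAt-updates k (cur s)) (updateAt-updates k (rest s))

    upcoming-advance-≢ : ∀ {j} → j ≢ k → upcoming (advance O k J js s) j ≡ upcoming s j
    upcoming-advance-≢ {j} j≢k =
      cong₂ (λ c r → fromMaybe c ++ r) (updateAt-minimal j k (cur s) j≢k) (updateAt-minimal j k (rest s) j≢k)

    cur-advance : cur (advance O k J js s) k ≡ just J
    cur-advance = updateAt-updates k (cur s)

    cur-advance-≢ : ∀ {j} → j ≢ k → cur (advance O k J js s) j ≡ cur s j
    cur-advance-≢ {j} = updateAt-minimal j k (cur s)

    upcoming-advance-⊆ : rest s k ≡ J ∷ js →
                         ∀ j {I} → I ∈ upcoming (advance O k J js s) j → I ∈ upcoming s j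
    upcoming-advance-⊆ rest≡ j I∈ with j Fin.≟ k
    ... | yes refl = rest⊆upcoming s k (subst (_ ∈_) (trans upcoming-advance (sym rest≡)) I∈)
    ... | no  j≢k  = subst (_ ∈_) (upcoming-advance-≢ j≢k) I∈

module Correctness {a ℓ : Level} (O : SuccOrder a ℓ) (n : ℕ) (A : Fin (suc n) → List (Interval O))
                   (nonEmpty : ∀ k → All (NonEmptyI O) (A k)) (antichain : ∀ k → IsAntichainList O (A k)) where
  open SuccOrder O
  open SuccOrderProperties O
  open IntervalLists O
  open Blocks O n A nonEmpty
  open AlgorithmState O n
  open Run O n using (m; outer; inner; pull; restart; remaining; next; calls)

  NoChainFrom : List (Interval O) → Set a
  NoChainFrom Is = ∀ {I} → IsChain I → I zero ∉ Is

  Skips : List (Interval O) → List (Interval O) → Set a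
  Skips xs ys = ∃ λ pre → xs ≡ pre ++ ys × NoChainFrom pre

  noChainFrom-++ : ∀ {xs ys} → NoChainFrom xs → NoChainFrom ys → NoChainFrom (xs ++ ys)
  noChainFrom-++ {xs} xs-dead ys-dead I-chain I0∈ with ∈-++⁻ xs I0∈
  ... | inj₁ I0∈xs = xs-dead I-chain I0∈xs
  ... | inj₂ I0∈ys = ys-dead I-chain I0∈ys

  skip : ∀ {xs y ys} → Skips xs (y ∷ ys) → NoChainFrom [ y ] → Skips xs ys
  skip {y = y} (pre , xs≡ , pre-dead) y-dead =
    pre ++ [ y ] , trans xs≡ (sym (++-assoc pre [ y ] _)) , noChainFrom-++ pre-dead y-dead

  skips-noChainFrom : ∀ {xs ys} → Skips xs ys → NoChainFrom ys → NoChainFrom xs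
  skips-noChainFrom (pre , xs≡ , pre-dead) ys-dead I-chain I0∈ =
    noChainFrom-++ pre-dead ys-dead I-chain (subst (_ ∈_) xs≡ I0∈)

  skips-sorted : ∀ {xs ys} → Sorted xs → Skips xs ys → Sorted ys
  skips-sorted xs↑ (pre , refl , _) = allPairs-++⁻ʳ pre xs↑

  skips-⊆ : ∀ {xs ys y} → Skips xs ys → y ∈ ys → y ∈ xs
  skips-⊆ (pre , refl , _) = ∈-++⁺ʳ pre

  skips-shorter : ∀ {xs y ys} → Skips xs (y ∷ ys) → length ys ℕ.< length xs
  skips-shorter {y = y} {ys} (pre , refl , _) = length-++-≤ʳ (y ∷ ys) {pre}

  chain-unique : ∀ {I I′} → IsChain I → IsChain I′ → I zero ≡ I′ zero → ∀ k → I k ≡ I′ k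
  chain-unique {I} {I′} I-chain I′-chain I0≡ = <-weakInduction (λ k → I k ≡ I′ k) I0≡ λ j I≡ →
    sorted⇒lo-injective (antichain⇒sorted (antichain (suc j)))
      (IsChain.member I-chain (suc j)) (IsChain.member I′-chain (suc j))
      (trans (IsChain.adjacent I-chain j) (trans (cong (succ ∘ hi) I≡) (sym (IsChain.adjacent I′-chain j))))

  span-unique : ∀ {I I′} → IsChain I → IsChain I′ → I zero ≡ I′ zero → span I ≡ span I′
  span-unique I-chain I′-chain I0≡ = cong₂ _,_ (cong lo (same zero)) (cong hi (same (Fin.fromℕ n)))
    where same = chain-unique I-chain I′-chain I0≡

  record Consistent (s : St) : Set (a ⊔ ℓ) where
    field
      sorted   : ∀ k → Sorted (upcoming s k)
      ⊆A       : ∀ k {I} → I ∈ upcoming s k → I ∈ A k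
      complete : ∀ {I} → IsChain I → I zero ∈ upcoming s zero → ∀ k → I k ∈ upcoming s k

  initial-consistent : Consistent (initState O n A)
  initial-consistent = record
    { sorted   = λ k → antichain⇒sorted (antichain k)
    ; ⊆A       = λ k I∈ → I∈
    ; complete = λ I-chain _ → IsChain.member I-chain
    }

  rest-sorted : ∀ {s} → Consistent s → ∀ k → Sorted (rest s k)
  rest-sorted {s} cons k = allPairs-++⁻ʳ (fromMaybe (cur s k)) (Consistent.sorted cons k)

  module _ {s} (cons : Consistent s) where
    open Consistent cons

    sorted-current : ∀ k {c} → cur s k ≡ just c → Sorted (c ∷ rest s k)
    sorted-current k cur≡ = subst Sorted (upcoming-just s k cur≡) (sorted k)

    chain-current : ∀ k {c} → cur s k ≡ just c →
                    ∀ {I} → IsChain I → I zero ∈ upcoming s zero → I k ∈ c ∷ rest s k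
    chain-current k cur≡ I-chain I0∈ = subst (_ ∈_) (upcoming-just s k cur≡) (complete I-chain I0∈ k)

  advance-consistent : ∀ {s k J js} → Consistent s → rest s k ≡ J ∷ js →
    (∀ {I} → IsChain I → I zero ∈ upcoming (advance O k J js s) zero → I k ∈ J ∷ js) →
    Consistent (advance O k J js s)
  advance-consistent {s} {k} {J} {js} cons rest≡ chains-ahead = record
    { sorted   = sorted′
    ; ⊆A       = λ j I∈ → ⊆A j (shrinks j I∈)
    ; complete = complete′
    }
    where
    open Consistent cons
    s′ = advance O k J js s
    shrinks : ∀ j {I} → I ∈ upcoming s′ j → I ∈ upcoming s j
    shrinks = upcoming-advance-⊆ {s} {k} {J} {js} rest≡
    sorted′ : ∀ j → Sorted (upcoming s′ j)
    sorted′ j with j Fin.≟ k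
    ... | yes refl = subst Sorted (trans rest≡ (sym (upcoming-advance {s} {k}))) (rest-sorted cons k)
    ... | no  j≢k  = subst Sorted (sym (upcoming-advance-≢ {s} {k} j≢k)) (sorted j)
    complete′ : ∀ {I} → IsChain I → I zero ∈ upcoming s′ zero → ∀ j → I j ∈ upcoming s′ j
    complete′ I-chain I0∈ j with j Fin.≟ k
    ... | yes refl = subst (_ ∈_) (sym (upcoming-advance {s} {k})) (chains-ahead I-chain I0∈)
    ... | no  j≢k  = subst (_ ∈_) (sym (upcoming-advance-≢ {s} {k} j≢k)) (complete I-chain (shrinks zero I0∈) j)

  -- The algorithm's index i is suc p, and l0, rp are its ℓ₀ and r_{i-1}; C is junk beyond p.
  record Prefix (s : St) (p : ℕ) (l0 rp : Carrier) : Set a where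
    field
      C        : Fin (suc n) → Interval O
      current  : ∀ t → toℕ t ℕ.≤ p → cur s t ≡ just (C t)
      adjacent : ∀ t → toℕ (suc t) ℕ.≤ p → lo (C (suc t)) ≡ succ (hi (C (inject₁ t)))
      first    : lo (C zero) ≡ l0
      last     : ∀ t → toℕ t ≡ p → hi (C t) ≡ rp
      forced   : ∀ {I} → IsChain I → I zero ≡ C zero → ∀ t → toℕ t ℕ.≤ p → I t ≡ C t

    through-C₀ : ∀ {I : Fin (suc n) → Interval O} → I zero ≡ C zero → I zero ∈ upcoming s zero
    through-C₀ {I} I0≡ = subst (I zero ∈_) (sym (upcoming-just s zero (current zero ℕ.z≤n))) (here I0≡)

  restart-prefix : ∀ {s J} → cur s zero ≡ just J → Prefix s 0 (lo J) (hi J)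
  restart-prefix {J = J} cur≡ = record
    { C        = λ _ → J
    ; current  = λ { zero _ → cur≡ }
    ; adjacent = λ _ ()
    ; first    = refl
    ; last     = λ { zero _ → refl }
    ; forced   = λ { _ I0≡ zero _ → I0≡ }
    }

  ≤⇒≢suc : ∀ {p t} {j : Fin n} → toℕ j ≡ p → toℕ t ℕ.≤ p → t ≢ suc j
  ≤⇒≢suc j≡p t≤p refl = ℕ.<-irrefl j≡p t≤p

  advance-prefix : ∀ {s p l0 rp J js} {j : Fin n} → toℕ j ≡ p → Prefix s p l0 rp →
                   Prefix (advance O (suc j) J js s) p l0 rp
  advance-prefix {s} {J = J} {js} j≡p prefix = record
    { C        = C
    ; current  = λ t t≤p → trans (cur-advance-≢ {s} {J = J} {js} (≤⇒≢suc j≡p t≤p)) (current t t≤p)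
    ; adjacent = adjacent
    ; first    = first
    ; last     = last
    ; forced   = forced
    }
    where open Prefix prefix

  -- cur s k cannot be the k-th interval of a chain whose (k-1)-th interval ends at or after rp.
  Stale : St → Carrier → Fin (suc n) → Set (a ⊔ ℓ)
  Stale s rp k = cur s k ≡ nothing ⊎ ∃ λ c → cur s k ≡ just c × ¬ rp < lo c

  -- The list being scanned is suc j, so the prefix ends at inject₁ j.
  module Frontier {s p l0 rp} (cons : Consistent s) (prefix : Prefix s p l0 rp) (j : Fin n) (j≡p : toℕ j ≡ p) where
    open Consistent cons
    open Prefix prefix

    private
      j′≡p : toℕ (inject₁ j) ≡ p
      j′≡p = trans (Fin.toℕ-inject₁ j) j≡p

    beyond : ∀ {I} → IsChain I → I zero ∈ upcoming s zero → rp < lo (I (suc j))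
    beyond {I} I-chain I0∈ =
      subst (rp <_) (sym (IsChain.adjacent I-chain j)) (≤-<-trans rp≤ (succ-< _))
      where
      current-j = current (inject₁ j) (ℕ.≤-reflexive j′≡p)
      rp≤ : rp ≤ hi (I (inject₁ j))
      rp≤ = subst (_≤ _) (last _ j′≡p)
              (sorted-head-hi≤ (sorted-current cons _ current-j) (chain-current cons _ current-j I-chain I0∈))

    stale⇒in-rest : Stale s rp (suc j) →
                    ∀ {I} → IsChain I → I zero ∈ upcoming s zero → I (suc j) ∈ rest s (suc j)
    stale⇒in-rest (inj₁ cur≡) I-chain I0∈ =
      subst (_ ∈_) (upcoming-nothing s (suc j) cur≡) (complete I-chain I0∈ (suc j))
    stale⇒in-rest (inj₂ (c , cur≡ , rp≮c)) I-chain I0∈ with chain-current cons (suc j) cur≡ I-chain I0∈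
    ... | here refl = ⊥-elim (rp≮c (beyond I-chain I0∈))
    ... | there I∈  = I∈

    chain-lo : ∀ {I} → IsChain I → I zero ≡ C zero → lo (I (suc j)) ≡ succ rp
    chain-lo {I} I-chain I0≡ = begin
      lo (I (suc j))             ≡⟨ IsChain.adjacent I-chain j ⟩
      succ (hi (I (inject₁ j)))  ≡⟨ cong (succ ∘ hi) (forced I-chain I0≡ _ (ℕ.≤-reflexive j′≡p)) ⟩
      succ (hi (C (inject₁ j)))  ≡⟨ cong succ (last _ j′≡p) ⟩
      succ rp                    ∎
      where open ≡-Reasoning

    mismatch : ∀ {l r} → cur s (suc j) ≡ just (l , r) → rp < l → l ≢ succ rp → NoChainFrom [ C zero ]
    mismatch {l} cur≡ rp<l l≢ {I} I-chain (here I0≡)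
      with chain-current cons (suc j) cur≡ I-chain (through-C₀ {I} I0≡)
    ... | here I≡  = l≢ (trans (cong lo (sym I≡)) (chain-lo I-chain I0≡))
    ... | there I∈ = succ-cover rp l (rp<l , subst (l <_) (chain-lo I-chain I0≡) l<)
      where l< = proj₁ (All.lookup (AllPairs.head (sorted-current cons (suc j) cur≡)) I∈)

    extend : ∀ {l r} → cur s (suc j) ≡ just (l , r) → l ≡ succ rp → Prefix s (suc p) l0 r
    extend {l} {r} cur≡ l≡ = record
      { C        = C′
      ; current  = current′
      ; adjacent = adjacent′
      ; first    = trans (cong lo (C′-below ℕ.z≤n)) first
      ; last     = λ t t≡ → cong hi (trans (cong C′ (at-suc-j t≡)) C′-new)
      ; forced   = forced′
      }
      where
      C′ : Fin (suc n) → Interval O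
      C′ = updateAt C (suc j) (λ _ → l , r)
      C′-below : ∀ {t} → toℕ t ℕ.≤ p → C′ t ≡ C t
      C′-below {t} t≤p = updateAt-minimal t (suc j) C (≤⇒≢suc j≡p t≤p)
      C′-new : C′ (suc j) ≡ (l , r)
      C′-new = updateAt-updates (suc j) C
      at-suc-j : ∀ {t} → toℕ t ≡ suc p → t ≡ suc j
      at-suc-j t≡ = Fin.toℕ-injective (trans t≡ (cong suc (sym j≡p)))
      split : ∀ t → toℕ t ℕ.≤ suc p → toℕ t ℕ.≤ p ⊎ t ≡ suc j
      split t t≤ with ℕ.m≤n⇒m<n∨m≡n t≤
      ... | inj₁ t< = inj₁ (ℕ.s≤s⁻¹ t<)
      ... | inj₂ t≡ = inj₂ (at-suc-j t≡)
      current′ : ∀ t → toℕ t ℕ.≤ suc p → cur s t ≡ just (C′ t)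
      current′ t t≤ with split t t≤
      ... | inj₁ t≤p  = trans (current t t≤p) (cong just (sym (C′-below t≤p)))
      ... | inj₂ refl = trans cur≡ (cong just (sym C′-new))
      adjacent′ : ∀ t → toℕ (suc t) ℕ.≤ suc p → lo (C′ (suc t)) ≡ succ (hi (C′ (inject₁ t)))
      adjacent′ t st≤ with split (suc t) st≤
      ... | inj₁ st≤p = trans (cong lo (C′-below st≤p))
                          (trans (adjacent t st≤p) (cong (succ ∘ hi) (sym (C′-below t′≤p))))
        where t′≤p = ℕ.≤-trans (ℕ.≤-reflexive (Fin.toℕ-inject₁ t)) (ℕ.<⇒≤ st≤p)
      ... | inj₂ refl = trans (cong lo C′-new) (trans l≡ (cong succ (trans (sym (last _ j′≡p))
                          (cong hi (sym (C′-below (ℕ.≤-reflexive j′≡p)))))))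
      forced′ : ∀ {I} → IsChain I → I zero ≡ C′ zero → ∀ t → toℕ t ℕ.≤ suc p → I t ≡ C′ t
      forced′ {I} I-chain I0≡′ t t≤ with split t t≤
      ... | inj₁ t≤p  = trans (forced I-chain I0≡ t t≤p) (sym (C′-below t≤p))
        where I0≡ = trans I0≡′ (C′-below ℕ.z≤n)
      ... | inj₂ refl = trans (sorted⇒lo-injective (sorted-current cons (suc j) cur≡)
                               (chain-current cons (suc j) cur≡ I-chain (through-C₀ {I} I0≡))
                               (here refl) (trans (chain-lo I-chain I0≡) (sym l≡)))
                              (sym C′-new)
        where I0≡ = trans I0≡′ (C′-below ℕ.z≤n)

  remaining-advance : ∀ {s k J js} → rest s k ≡ J ∷ js → remaining (advance O k J js s) ℕ.< remaining s
  remaining-advance {s} {k} {J} {js} rest≡ = subst₂ ℕ._<_ (sum-lengths s′) (sum-lengths s)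
    (sum-map-< (λ j → length (rest s′ j)) (λ j → length (rest s j)) shorter (∈-allFin k) shorter-at-k)
    where
    s′ = advance O k J js s
    sum-lengths : ∀ s → sum (map (λ j → length (rest s j)) (allFin m)) ≡ remaining s
    sum-lengths s = cong sum (map-∘ (allFin m))
    shorter-at-k : length (rest s′ k) ℕ.< length (rest s k)
    shorter-at-k rewrite updateAt-updates k {λ _ → js} (rest s) | rest≡ = ℕ.≤-refl
    shorter : ∀ j → length (rest s′ j) ℕ.≤ length (rest s j)
    shorter j with j Fin.≟ k
    ... | yes refl = ℕ.<⇒≤ shorter-at-k
    ... | no  j≢k  = ℕ.≤-reflexive (cong length (updateAt-minimal j k (rest s) j≢k))

  -- A call at index i needs at most budget s ∸ (i + i) fuel: each pull lowers remaining s, paying the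
  -- m + m units for climbing back from 1 to m at two calls (inner, outer) per level.
  budget : St → ℕ
  budget s = (m + m) * remaining s + (m + m)

  budget-advance : ∀ {s k J js} → rest s k ≡ J ∷ js → budget (advance O k J js s) ℕ.≤ (m + m) * remaining s
  budget-advance {s} {k} {J} {js} rest≡ = begin
    (m + m) * remaining s′ + (m + m)  ≡⟨ ℕ.+-comm _ (m + m) ⟩
    (m + m) + (m + m) * remaining s′  ≡⟨ ℕ.*-suc (m + m) (remaining s′) ⟨
    (m + m) * suc (remaining s′)      ≤⟨ ℕ.*-monoʳ-≤ (m + m) (remaining-advance {s} {k} rest≡) ⟩
    (m + m) * remaining s             ∎
    where
    open ℕ.≤-Reasoning
    s′ = advance O k J js s

  budget-advance-< : ∀ {s k J js} → rest s k ≡ J ∷ js → budget (advance O k J js s) ℕ.< budget s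
  budget-advance-< {s} {k} rest≡ =
    ℕ.≤-<-trans (budget-advance {s} {k} rest≡) (ℕ.m<m+n ((m + m) * remaining s) (ℕ.s≤s ℕ.z≤n))

  budget-initial : ∀ s → (m + m) * remaining s ℕ.≤ suc (4 * suc (remaining s) * suc m)
  budget-initial s =
    ℕ.≤-trans (ℕ.m≤m+n _ _) (ℕ.≤-trans (ℕ.n≤1+n _) (ℕ.≤-reflexive (cong suc (expand m (remaining s)))))
    where
    open +-*-Solver
    expand : ∀ m r → (m + m) * r + (2 * m * r + 4 * r + 4 * m + 4) ≡ 4 * suc r * suc m
    expand = solve 2 (λ m r → (m :+ m) :* r :+ (con 2 :* m :* r :+ con 4 :* r :+ con 4 :* m :+ con 4)
                              := con 4 :* (con 1 :+ r) :* (con 1 :+ m)) refl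

  budget-climb : ∀ {B} f i → B ℕ.≤ suc f + (i + i) → suc B ℕ.≤ f + (suc i + suc i)
  budget-climb {B} f i B≤ = subst (suc B ℕ.≤_) (sym two-levels) (ℕ.s≤s B≤)
    where
    two-levels : f + (suc i + suc i) ≡ suc (suc f + (i + i))
    two-levels = begin
      f + suc (i + suc i)   ≡⟨ ℕ.+-suc f (i + suc i) ⟩
      suc (f + (i + suc i)) ≡⟨ cong (λ x → suc (f + x)) (ℕ.+-suc i i) ⟩
      suc (f + suc (i + i)) ≡⟨ cong suc (ℕ.+-suc f (i + i)) ⟩
      suc (suc f + (i + i)) ∎
      where open ≡-Reasoning

  Outcome : List (Interval O) → Result O n → Set (a ⊔ ℓ)
  Outcome R0 (nothing , _) = Lift ℓ (NoChainFrom R0)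
  Outcome R0 (just J , s)  = Consistent s × ∃ λ I → IsChain I × Skips R0 (I zero ∷ rest s zero) × J ≡ span I

  full-prefix-chain : ∀ {s p l0 rp} → Consistent s → p ≡ n → (prefix : Prefix s p l0 rp) →
                      IsChain (Prefix.C prefix) × (l0 , rp) ≡ span (Prefix.C prefix)
  full-prefix-chain {s} cons refl prefix =
    record { member = member ; adjacent = λ t → adjacent t (Fin.toℕ<n t) } ,
    cong₂ _,_ (sym first) (sym (last (fromℕ n) (Fin.toℕ-fromℕ n)))
    where
    open Prefix prefix
    member : ∀ k → C k ∈ A k
    member k = Consistent.⊆A cons k
      (subst (C k ∈_) (sym (upcoming-just s k (current k (Fin.toℕ≤pred[n] k)))) (here refl))

  outer-correct : ∀ {R0 p l0 rp s} f → suc p ℕ.≤ m → Consistent s → Prefix s p l0 rp →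
    Skips R0 (upcoming s zero) → suc (budget s) ℕ.≤ f + (suc p + suc p) → Outcome R0 (outer f (suc p) l0 rp s)

  inner-correct : ∀ {R0 p l0 rp s} f j → toℕ j ≡ p → suc p ℕ.< m → Consistent s → Prefix s p l0 rp →
    Skips R0 (upcoming s zero) → budget s ℕ.≤ f + (suc p + suc p) → Outcome R0 (inner f (suc j) (suc p) l0 rp s)

  pull-correct : ∀ {R0 p l0 rp s} f j → toℕ j ≡ p → suc p ℕ.< m → Consistent s → Prefix s p l0 rp →
    Skips R0 (upcoming s zero) → Stale s rp (suc j) → budget s ℕ.≤ suc f + (suc p + suc p) →
    Outcome R0 (pull f (suc j) (suc p) l0 rp s)

  restart-correct : ∀ {R0 s} f → Consistent s → Skips R0 (rest s zero) → (m + m) * remaining s ℕ.≤ suc f →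
    Outcome R0 (restart f s)

  outer-correct {s = s} zero p<m _ _ _ fuel =
    ⊥-elim (ℕ.<⇒≱ fuel (ℕ.≤-trans (ℕ.+-mono-≤ p<m p<m) (ℕ.m≤n+m (m + m) ((m + m) * remaining s))))
  outer-correct {R0} {p} {l0} {rp} {s} (suc f) p<m cons prefix skips fuel with suc p ℕ.<? m
  ... | yes p+1<m =
    inner-correct f _ (Fin.toℕ-fromℕ< (ℕ.s<s⁻¹ p+1<m)) p+1<m cons prefix skips (ℕ.s≤s⁻¹ fuel)
  ... | no  p+1≮m =
    let C-chain , span≡ = full-prefix-chain cons (ℕ.suc-injective (ℕ.≤-antisym p<m (ℕ.≮⇒≥ p+1≮m))) prefix
    in cons , C , C-chain , subst (Skips R0) (upcoming-just s zero (current zero ℕ.z≤n)) skips , span≡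
    where open Prefix prefix

  inner-correct {s = s} zero j j≡p p<m _ _ _ fuel =
    ⊥-elim (ℕ.<⇒≱ (ℕ.<-≤-trans (ℕ.+-mono-< p<m p<m) (ℕ.m≤n+m (m + m) ((m + m) * remaining s))) fuel)
  inner-correct {R0} {p} {l0} {rp} {s} (suc f) j j≡p p<m cons prefix skips fuel
    with State.cur s (suc j) in cur≡
  ... | nothing = pull-correct f j j≡p p<m cons prefix skips (inj₁ cur≡) fuel
  ... | just (l , r) with rp <? l
  ...   | no  rp≮l =
    pull-correct f j j≡p p<m cons prefix skips (inj₂ ((l , r) , cur≡ , rp≮l)) fuel
  ...   | yes rp<l with l ≟ succ rp
  ...     | yes l≡ = outer-correct f p<m cons (extend cur≡ l≡) skips (budget-climb f (suc p) fuel)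
    where open Frontier cons prefix j j≡p
  ...     | no  l≢ =
    restart-correct f cons (skip skips₀ (mismatch cur≡ rp<l l≢))
      (ℕ.+-cancelʳ-≤ (suc p + suc p) _ _
        (ℕ.≤-trans (ℕ.+-monoʳ-≤ ((m + m) * remaining s) (ℕ.<⇒≤ (ℕ.+-mono-< p<m p<m))) fuel))
    where
    open Prefix prefix
    open Frontier cons prefix j j≡p
    skips₀ : Skips R0 (C zero ∷ rest s zero)
    skips₀ = subst (Skips R0) (upcoming-just s zero (current zero ℕ.z≤n)) skips

  pull-correct {R0} {p} {l0} {rp} {s} f j j≡p p<m cons prefix skips stale fuel
    with State.rest s (suc j) in rest≡
  ... | [] = lift (skips-noChainFrom skips λ {I} I-chain I0∈ →
                  ¬Any[] (subst (I (suc j) ∈_) rest≡ (stale⇒in-rest stale I-chain I0∈)))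
    where open Frontier cons prefix j j≡p
  ... | J ∷ js = inner-correct f j j≡p p<m
                   (advance-consistent cons rest≡ λ {I} I-chain I0∈ → subst (I (suc j) ∈_) rest≡
                      (stale⇒in-rest stale I-chain (subst (I zero ∈_) zero-unchanged I0∈)))
                   (advance-prefix j≡p prefix)
                   (subst (Skips R0) (sym zero-unchanged) skips)
                   (ℕ.s≤s⁻¹ (ℕ.<-≤-trans (budget-advance-< {s} {suc j} rest≡) fuel))
    where
    open Frontier cons prefix j j≡p
    zero-unchanged : upcoming (advance O (suc j) J js s) zero ≡ upcoming s zero
    zero-unchanged = upcoming-advance-≢ {s} {suc j} {J} {js} λ ()

  restart-correct {R0} {s} f cons skips fuel =
    restarted skips λ {J} {js} rest≡ → ℕ.≤-trans (budget-advance {s} {zero} {J} {js} rest≡) fuel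
    where
    -- The fuel bound is restated before the case split on rest s zero, which would rewrite
    -- remaining s inside it.
    restarted : Skips R0 (rest s zero) →
                (∀ {J js} → rest s zero ≡ J ∷ js → budget (advance O zero J js s) ℕ.≤ suc f) →
                Outcome R0 (restart f s)
    restarted skips fuel′ with State.rest s zero in rest≡
    ... | [] = lift (skips-noChainFrom skips λ _ ())
    ... | J ∷ js = outer-correct f (ℕ.s≤s ℕ.z≤n)
                     (advance-consistent cons rest≡ λ {I} I-chain I0∈ →
                        subst (I zero ∈_) (upcoming-advance {s} {zero}) I0∈)
                     (restart-prefix (cur-advance {s} {zero} {J} {js}))
                     (subst (Skips R0) (sym (upcoming-advance {s} {zero})) skips)
                     (subst (suc (budget (advance O zero J js s)) ℕ.≤_) (ℕ.+-comm 2 f) (ℕ.s≤s (fuel′ refl)))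

  next-correct : ∀ {s} → Consistent s → Outcome (rest s zero) (next s)
  next-correct {s} cons = restart-correct _ cons ([] , refl , λ _ ()) (budget-initial s)

  Enumerates : List (Interval O) → List (Interval O) → Set a
  Enumerates R Js = ∀ J → J ∈ Js ⇔ ∃ λ I → IsChain I × I zero ∈ R × J ≡ span I

  enumerates-∷ : ∀ {R ys Js I J} → Skips R (I zero ∷ ys) → IsChain I → J ≡ span I →
                 Enumerates ys Js → Enumerates R (J ∷ Js)
  enumerates-∷ {I = I} {J} skips@(pre , refl , pre-dead) I-chain J≡ enum J′ = mk⇔ listed chained
    where
    listed : J′ ∈ J ∷ _ → ∃ λ I′ → IsChain I′ × I′ zero ∈ pre ++ I zero ∷ _ × J′ ≡ span I′
    listed (here refl) = I , I-chain , skips-⊆ skips (here refl) , J≡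
    listed (there J′∈) = let I′ , I′-chain , I′0∈ , J′≡ = Equivalence.to (enum J′) J′∈
                         in I′ , I′-chain , skips-⊆ skips (there I′0∈) , J′≡
    chained : (∃ λ I′ → IsChain I′ × I′ zero ∈ pre ++ I zero ∷ _ × J′ ≡ span I′) → J′ ∈ J ∷ _
    chained (I′ , I′-chain , I′0∈ , J′≡) with ∈-++⁻ pre I′0∈
    ... | inj₁ I′0∈pre      = ⊥-elim (pre-dead I′-chain I′0∈pre)
    ... | inj₂ (here I′0≡)  = here (trans J′≡ (trans (span-unique I′-chain I-chain I′0≡) (sym J≡)))
    ... | inj₂ (there I′0∈) = there (Equivalence.from (enum J′) (I′ , I′-chain , I′0∈ , J′≡))

  fresh : ∀ {ys Js I J} → Sorted (I zero ∷ ys) → J ≡ span I → Enumerates ys Js → All (J ≢_) Js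
  fresh {I = I} {J} sorted J≡ enum = All.tabulate λ {J′} J′∈ J≡J′ →
    let I′ , _ , I′0∈ , J′≡ = Equivalence.to (enum J′) J′∈
    in <-irrefl (subst (lo (I zero) <_) (cong lo (trans (sym J′≡) (trans (sym J≡J′) J≡)))
                       (proj₁ (All.lookup (AllPairs.head sorted) I′0∈)))

  enumerate : ∀ s → Consistent s → Acc ℕ._<_ (length (rest s zero)) →
    Σ (List (Interval O)) λ Js →
      calls (suc (length Js)) s ≡ map just Js ++ [ nothing ] × Unique Js × Enumerates (rest s zero) Js
  enumerate s cons (acc shorter) with next s | next-correct {s} cons
  ... | nothing , _ | lift none =
    [] , refl , [] , λ J → mk⇔ (λ ()) (λ (_ , I-chain , I0∈ , _) → ⊥-elim (none I-chain I0∈))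
  ... | just J , s′ | cons′ , I , I-chain , skips , J≡ =
    let Js , calls≡ , unique , enum = enumerate s′ cons′ (shorter (skips-shorter skips))
    in J ∷ Js , cong (just J ∷_) calls≡ ,
       fresh {I = I} (skips-sorted (rest-sorted cons zero) skips) J≡ enum ∷ unique ,
       enumerates-∷ skips I-chain J≡ enum

mainTheorem7 : {a ℓ : Level} (O : SuccOrder a ℓ) (n : ℕ)
    (A : Fin (suc n) → List (Interval O)) →
    (∀ i → A i ≢ []) →
    (∀ i → All (NonEmptyI O) (A i)) →
    (∀ i → IsAntichainList O (A i)) →
    Σ (List (Interval O)) (λ Js →
      (Run.calls O n (suc (length Js)) (initState O n A) ≡ map just Js ++ nothing ∷ [])
      × Unique Js
      × (∀ J → (J ∈ Js) ⇔ InBLOCK O n A J))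
-- The lists need not be nonempty: an exhausted list simply ends the enumeration.
mainTheorem7 O n A _ nonEmpty antichain =
  let Js , calls≡ , unique , enum = enumerate (initState O n A) initial-consistent (<-wellFounded _)
  in Js , calls≡ , unique , λ J → mk⇔ (block ∘ Equivalence.to (enum J)) (Equivalence.from (enum J) ∘ chain)
  where
  open Blocks O n A nonEmpty
  open Correctness O n A nonEmpty antichain
  block : ∀ {J} → (∃ λ I → IsChain I × I zero ∈ A zero × J ≡ span I) → InBLOCK O n A J
  block (I , I-chain , _ , J≡) = subst (InBLOCK O n A) (sym J≡) (chain⇒InBLOCK I-chain)
  chain : ∀ {J} → InBLOCK O n A J → ∃ λ I → IsChain I × I zero ∈ A zero × J ≡ span I
  chain J∈ = let I , I-chain , J≡ = InBLOCK⇒chain J∈ in I , I-chain , IsChain.member I-chain zero , J≡
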